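{- Let $\mathbf{s}=(s_1,\ldots,s_r)$ be integers greater than $1$, $G=\mathbb{Z}_{s_1}\times\cdots\times\mathbb{Z}_{s_r}$, $\mathbf{z}\in\{0,1\}^r$ with $\mathbf{z}\neq\mathbf{0}$, and let $\phi:G\to\{\pm1\}$ with $\phi(0)=1$. Let $\psi=f_{\mathbf z}\,\partial\phi$ and let $\Gamma:E_\psi\to E/K$ be the map $\Gamma(u,x)=\iota(u\phi(x))+\tau(x)$ (notation in the context). Then $\Gamma$ maps $\{(1,x)\mid x\in G\}\subseteq E_\psi$ onto $\{g+K\in E/K\mid \phi'(g)=1\}$.
   Context: Cyclic groups are written additively. $E=\mathbb{Z}_{(z_1+1)s_1}\times\cdots\times\mathbb{Z}_{(z_r+1)s_r}$, $H=\{h\in E : h_i=0 \text{ if } z_i=0,\ h_i\in\{0,s_i\}\text{ if } z_i=1\}$, $K=\{k\in H: k\text{ has an even number of nonzero coordinates}\}$; since $\mathbf z\ne\mathbf 0$, $H/K$ has order 2. Let $\iota:\{\pm1\}\to E/K$ be the injective homomorphism sending $-1$ to the generator of $H/K$. Identify $x\in G$ with the element of $E$ having coordinates $x_i\in\{0,\ldots,s_i-1\}$, and set $\tau(x)=x+K$. Define $f_{\mathbf z}(x,y)=\iota^{ -1}(\tau(x)+\tau(y)-\tau(x+y))\in\{\pm1\}$ for $x,y\in G$ (a cocycle). For $\phi:G\to\{\pm1\}$, $\partial\phi(x,y)=\phi(x)\phi(y)\phi(x+y)$. For a cocycle $\psi:G\times G\to\{\pm1\}$, $E_\psi$ is the group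 on $\{\pm1\}\times G$ with $(u,x)(v,y)=(uv\,\psi(x,y),x+y)$. For $g\in E$ with reduction $a$ modulo $\mathbf s$ (coordinatewise), the expansion is $\phi'(g)=\phi(a)$ if $g\in a+K$ and $-\phi(a)$ otherwise. -}

module Defs where

open import Data.Nat as ℕ using (ℕ; zero; suc; _<_)
open import Data.Nat.Divisibility using (_∣?_)
open import Data.Integer as ℤ using (ℤ; +_; _-_)
open import Data.Integer.DivMod using (_%ℕ_)
open import Data.Integer.Divisibility using (_∣_)
open import Data.Bool using (Bool; true; false; if_then_else_)
open import Data.Fin using (Fin)
open import Data.Vec using (Vec; lookup; tabulate)
open import Data.List using (map; allFin)
open import Data.Nat.ListAction using (sum)
open import Data.Sign using (Sign; opposite)
open import Data.Product using (_×_)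
open import Data.Sum using (_⊎_)
open import Relation.Nullary using (¬_; does)
open import Relation.Binary.PropositionalEquality using (_≡_)

-- Parameters: r, the vector t with s_i = 2 + t_i (so every s_i > 1),
-- and z ∈ {0,1}^r encoded as a vector of booleans (true = 1).
module Setup (r : ℕ) (t : Vec ℕ r) (z : Vec Bool r) where

  s : Fin r → ℕ
  s i = suc (suc (lookup t i))

  m : Fin r → ℕ
  m i = (if lookup z i then 2 else 1) ℕ.* s i

  -- G = Z_{s_1} × ... × Z_{s_r}: vectors of canonical representatives
  InG : Vec ℕ r → Set
  InG x = (i : Fin r) → lookup x i < s i

  zeroG : Vec ℕ r
  zeroG = tabulate (λ _ → 0)

  -- Elements of E = Z_{m_1} × ... × Z_{m_r} are given by integer
  -- representatives; a coordinate is 0 in Z_{m_i} iff m_i divides it.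
  E : Set
  E = Fin r → ℤ

  _-E_ : E → E → E
  (g -E h) i = g i - h i

  ≡[m_] : Fin r → ℤ → ℤ → Set
  ≡[m_] i a b = (+ m i) ∣ (a - b)

  InH : E → Set
  InH h = (i : Fin r) →
    (lookup z i ≡ false → ≡[m_] i (h i) (+ 0)) ×
    (lookup z i ≡ true → ≡[m_] i (h i) (+ 0) ⊎ ≡[m_] i (h i) (+ s i))

  nonzeroCount : E → ℕ
  nonzeroCount h =
    sum (map (λ i → if does (m i ∣? ℤ.∣ h i ∣) then 0 else 1) (allFin r))

  InK : E → Set
  InK h = InH h × (2 Data.Nat.Divisibility.∣ nonzeroCount h)

  emb : Vec ℕ r → E
  emb x i = + lookup x i

  -- ι : {±1} → E/K, viewed as the coset ι(u) ⊆ E: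
  -- ι(+1) = K (the trivial coset), ι(-1) = H ∖ K (the generator of H/K).
  Inι : Sign → E → Set
  Inι Sign.+ h = InK h
  Inι Sign.- h = InH h × ¬ InK h

  -- g ∈ Γ(u,x) = ι(u φ(x)) + τ(x)   iff   g - x ∈ ι(u φ(x))
  InΓ : (Vec ℕ r → Sign) → Sign → Vec ℕ r → E → Set
  InΓ φ u x g = Inι (u Data.Sign.* φ x) (g -E emb x)

  reduce : E → Vec ℕ r
  reduce g = tabulate (λ i → g i %ℕ s i)

  PhiPrimeIs : (Vec ℕ r → Sign) → E → Sign → Set
  PhiPrimeIs φ g v =
    (InK (g -E emb (reduce g)) × φ (reduce g) ≡ v) ⊎
    (¬ InK (g -E emb (reduce g)) × opposite (φ (reduce g)) ≡ v)

-- Every element of H is coordinatewise a multiple of s, so an element g of the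
-- coset τ(x) + ι(±1) ⊆ τ(x) + H reduces modulo s to x itself; hence φ'(g) is
-- computed from x, and φ'(g) = 1 says exactly that g − x lies in ι(φ(x)).
-- Conversely g − reduce(g) always lies in H: its i-th coordinate is q s_i,
-- which is 0 or s_i modulo 2 s_i according to the parity of q.
module Submission where

open import Defs
open import Data.Nat using (ℕ)
open import Data.Bool using (Bool; true)
open import Data.Fin using (Fin)
open import Data.Vec using (Vec; lookup)
open import Data.Sign using (Sign)
open import Data.Product using (Σ; _×_; ∃)
open import Relation.Binary.PropositionalEquality using (_≡_)

import Data.Nat as ℕ
import Data.Nat.Properties as ℕ
import Data.Nat.Divisibility as ℕ
open import Data.Bool using (false; if_then_else_)
open import Data.Integer using (ℤ; +_; _-_; _+_; _*_; ∣_∣)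
open import Data.Integer.Properties
  using (+-injective; m-n≡m⊖n; ∣m⊝n∣≤m⊔n; ∣i∣≡0⇒i≡0; i-j≡0⇒i≡j; +-identityˡ; +-identityʳ; pos-*)
open import Data.Integer.DivMod using (_%ℕ_; _/ℕ_; n%ℕd<d; a≡a%ℕn+[a/ℕn]*n)
open import Data.Integer.Divisibility as Unsigned using ()
open import Data.Integer.Divisibility.Signed
  using (_∣_; divides; ∣ᵤ⇒∣; ∣⇒∣ᵤ; ∣-refl; ∣m∣n⇒∣m-n; ∣m∣n⇒∣m+n)
open import Data.Integer.Tactic.RingSolver using (solve-∀)
open import Data.Vec.Properties using (lookup∘tabulate; tabulate∘lookup; tabulate-cong)
open import Data.Product using (_,_)
open import Data.Sum using (_⊎_; inj₁; inj₂; map)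
open import Data.Sign using (opposite)
open import Relation.Nullary using (¬_; contradiction)
open import Relation.Binary.PropositionalEquality using (refl; sym; trans; cong; subst; module ≡-Reasoning)

∣-of-smaller⇒≡ : ∀ {n r x} → r ℕ.< n → x ℕ.< n → + n ∣ + r - + x → r ≡ x
∣-of-smaller⇒≡ {n} {r} {x} r<n x<n n∣r-x =
  +-injective (i-j≡0⇒i≡j (+ r) (+ x) (∣i∣≡0⇒i≡0 (small-multiple≡0 ∣ + r - + x ∣ dist<n n∣dist)))
  where
  small-multiple≡0 : ∀ d → d ℕ.< n → n ℕ.∣ d → d ≡ 0
  small-multiple≡0 ℕ.zero    _   _   = refl
  small-multiple≡0 (ℕ.suc d) d<n n∣d = contradiction n∣d (ℕ.>⇒∤ d<n)

  dist<n : ∣ + r - + x ∣ ℕ.< n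
  dist<n = subst (ℕ._< n) (cong ∣_∣ (sym (m-n≡m⊖n r x)))
    (ℕ.≤-<-trans (∣m⊝n∣≤m⊔n r x) (ℕ.⊔-pres-<m r<n x<n))

  n∣dist : n ℕ.∣ ∣ + r - + x ∣
  n∣dist = ∣⇒∣ᵤ n∣r-x

a-a%ℕn≡[a/ℕn]*n : ∀ a n .{{_ : ℕ.NonZero n}} → a - + (a %ℕ n) ≡ (a /ℕ n) * + n
a-a%ℕn≡[a/ℕn]*n a n = trans (cong (_- + (a %ℕ n)) (a≡a%ℕn+[a/ℕn]*n a n)) (cancel (+ (a %ℕ n)) (a /ℕ n) (+ n))
  where
  cancel : ∀ r q n → (r + q * n) - r ≡ q * n
  cancel = solve-∀

%ℕ-canonical : ∀ a {n x} .{{_ : ℕ.NonZero n}} → x ℕ.< n → + n ∣ a - + x → a %ℕ n ≡ x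
%ℕ-canonical a {n} {x} x<n n∣a-x = ∣-of-smaller⇒≡ (n%ℕd<d a n) x<n
  (subst (+ n ∣_) (difference a (+ (a %ℕ n)) (+ x))
    (∣m∣n⇒∣m-n n∣a-x (divides (a /ℕ n) (a-a%ℕn≡[a/ℕn]*n a n))))
  where
  difference : ∀ a r x → (a - x) - (a - r) ≡ r - x
  difference = solve-∀

∣ᵤ-multiple⇒∣ : ∀ c {n} h → + (c ℕ.* n) Unsigned.∣ h → + n ∣ h
∣ᵤ-multiple⇒∣ c h cn∣h = ∣ᵤ⇒∣ (ℕ.∣-trans (ℕ.n∣m*n c) cn∣h)

factor : Bool → ℕ → ℕ
factor b s = (if b then 2 else 1) ℕ.* s

-- InH h unfolds to ∀ i → CoordOfH (lookup z i) (s i) (h i).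
CoordOfH : Bool → ℕ → ℤ → Set
CoordOfH b s h =
  (b ≡ false → + factor b s Unsigned.∣ h - + 0) ×
  (b ≡ true → + factor b s Unsigned.∣ h - + 0 ⊎ + factor b s Unsigned.∣ h - + s)

CoordOfH⇒∣ : ∀ b s h → CoordOfH b s h → + s ∣ h
CoordOfH⇒∣ false s h (h∈H , _) = subst (+ s ∣_) (+-identityʳ h) (∣ᵤ-multiple⇒∣ 1 _ (h∈H refl))
CoordOfH⇒∣ true  s h (_ , h∈H) with h∈H refl
... | inj₁ 2s∣h   = subst (+ s ∣_) (+-identityʳ h) (∣ᵤ-multiple⇒∣ 2 _ 2s∣h)
... | inj₂ 2s∣h-s = subst (+ s ∣_) (h-s+s h (+ s)) (∣m∣n⇒∣m+n (∣ᵤ-multiple⇒∣ 2 (h - + s) 2s∣h-s) ∣-refl)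
  where
  h-s+s : ∀ h s → (h - s) + s ≡ h
  h-s+s = solve-∀

even-or-odd : ∀ q → q ≡ (q /ℕ 2) * + 2 ⊎ q ≡ + 1 + (q /ℕ 2) * + 2
even-or-odd q with q %ℕ 2 | n%ℕd<d q 2 | a≡a%ℕn+[a/ℕn]*n q 2
... | 0 | _ | q≡ = inj₁ (trans q≡ (+-identityˡ _))
... | 1 | _ | q≡ = inj₂ q≡
... | ℕ.suc (ℕ.suc _) | ℕ.s≤s (ℕ.s≤s ()) | _

CoordOfH-multiple : ∀ b s q → CoordOfH b s (q * + s)
CoordOfH-multiple false s q =
  (λ _ → ∣⇒∣ᵤ (divides q (trans (+-identityʳ _) (cong (λ k → q * + k) (sym (ℕ.*-identityˡ s)))))) , λ ()
CoordOfH-multiple true  s q = (λ ()) , λ _ → map even-case odd-case (even-or-odd q)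
  where
  open ≡-Reasoning
  h : ℤ
  h = q /ℕ 2

  2s : ℤ
  2s = + factor true s

  even-case : q ≡ h * + 2 → 2s Unsigned.∣ q * + s - + 0
  even-case q≡ = ∣⇒∣ᵤ (divides h (begin
    q * + s - + 0          ≡⟨ cong (λ q → q * + s - + 0) q≡ ⟩
    (h * + 2) * + s - + 0  ≡⟨ even h (+ s) ⟩
    h * (+ 2 * + s)        ≡⟨ cong (h *_) (sym (pos-* 2 s)) ⟩
    h * 2s                 ∎))
    where
    even : ∀ h s → (h * + 2) * s - + 0 ≡ h * (+ 2 * s)
    even = solve-∀

  odd-case : q ≡ + 1 + h * + 2 → 2s Unsigned.∣ q * + s - + s
  odd-case q≡ = ∣⇒∣ᵤ (divides h (begin
    q * + s - + s                ≡⟨ cong (λ q → q * + s - + s) q≡ ⟩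
    (+ 1 + h * + 2) * + s - + s  ≡⟨ odd h (+ s) ⟩
    h * (+ 2 * + s)              ≡⟨ cong (h *_) (sym (pos-* 2 s)) ⟩
    h * 2s                       ∎))
    where
    odd : ∀ h s → (+ 1 + h * + 2) * s - s ≡ h * (+ 2 * s)
    odd = solve-∀

module _ (r : ℕ) (t : Vec ℕ r) (z : Vec Bool r) where
  open Setup r t z

  InH⇒∣ : ∀ h → InH h → ∀ i → + s i ∣ h i
  InH⇒∣ h h∈H i = CoordOfH⇒∣ (lookup z i) (s i) (h i) (h∈H i)

  lookup-reduce : ∀ g i → lookup (reduce g) i ≡ g i %ℕ s i
  lookup-reduce g i = lookup∘tabulate (λ j → g j %ℕ s j) i

  reduce-InG : ∀ g → InG (reduce g)
  reduce-InG g i = subst (ℕ._< s i) (sym (lookup-reduce g i)) (n%ℕd<d (g i) (s i))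

  reduce-unique : ∀ {x} g → InG x → InH (g -E emb x) → reduce g ≡ x
  reduce-unique {x} g x∈G g-x∈H = trans
    (tabulate-cong (λ i → %ℕ-canonical (g i) (x∈G i) (InH⇒∣ (g -E emb x) g-x∈H i)))
    (tabulate∘lookup x)

  diff-reduce-InH : ∀ g → InH (g -E emb (reduce g))
  diff-reduce-InH g i rewrite lookup-reduce g i =
    subst (CoordOfH (lookup z i) (s i)) (sym (a-a%ℕn≡[a/ℕn]*n (g i) (s i)))
      (CoordOfH-multiple (lookup z i) (s i) (g i /ℕ s i))

  Inι⇒InH : ∀ a {d} → Inι a d → InH d
  Inι⇒InH Sign.+ (d∈H , _) = d∈H
  Inι⇒InH Sign.- (d∈H , _) = d∈H

  -- d + K = ι(a); for d = g − reduce g and a = φ(reduce g) this is PhiPrimeIs φ g +1.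
  CosetOf : E → Sign → Set
  CosetOf d a = (InK d × a ≡ Sign.+) ⊎ (¬ InK d × opposite a ≡ Sign.+)

  Inι⇒CosetOf : ∀ a {d} → Inι a d → CosetOf d a
  Inι⇒CosetOf Sign.+ d∈K       = inj₁ (d∈K , refl)
  Inι⇒CosetOf Sign.- (_ , d∉K) = inj₂ (d∉K , refl)

  CosetOf⇒Inι : ∀ a {d} → InH d → CosetOf d a → Inι a d
  CosetOf⇒Inι Sign.+ _   (inj₁ (d∈K , _)) = d∈K
  CosetOf⇒Inι Sign.- d∈H (inj₂ (d∉K , _)) = d∈H , d∉K
  CosetOf⇒Inι Sign.+ _   (inj₂ (_ , ()))
  CosetOf⇒Inι Sign.- _   (inj₁ (_ , ()))

  Γ-image⊆φ′⁻¹[+] : ∀ φ x → InG x → ∀ g → InΓ φ Sign.+ x g → PhiPrimeIs φ g Sign.+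
  Γ-image⊆φ′⁻¹[+] φ x x∈G g g∈Γx =
    subst (λ a → CosetOf (g -E emb a) (φ a)) (sym (reduce-unique g x∈G (Inι⇒InH (φ x) g∈Γx)))
      (Inι⇒CosetOf (φ x) g∈Γx)

  φ′⁻¹[+]⊆Γ-image : ∀ φ g → PhiPrimeIs φ g Sign.+ → Σ (Vec ℕ r) λ x → InG x × InΓ φ Sign.+ x g
  φ′⁻¹[+]⊆Γ-image φ g φ′g≡+ =
    reduce g , reduce-InG g , CosetOf⇒Inι (φ (reduce g)) (diff-reduce-InH g) φ′g≡+

lemma3 : (r : ℕ) (t : Vec ℕ r) (z : Vec Bool r) →
    let open Setup r t z in
    (∃ λ (i : Fin r) → lookup z i ≡ true) →
    (φ : Vec ℕ r → Sign) → φ zeroG ≡ Sign.+ →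
    ((x : Vec ℕ r) → InG x → (g : E) → InΓ φ Sign.+ x g → PhiPrimeIs φ g Sign.+)
    × ((g : E) → PhiPrimeIs φ g Sign.+ → Σ (Vec ℕ r) λ x → InG x × InΓ φ Sign.+ x g)
lemma3 r t z _ φ _ = Γ-image⊆φ′⁻¹[+] r t z φ , φ′⁻¹[+]⊆Γ-image r t z φ
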